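{- Let $n\geq 5$ and let $T^{*}$ be a chemical tree on $n$ vertices such that $ZC_{1}^{*}(T^{*})\geq ZC_{1}^{*}(T)$ for every chemical tree $T$ on $n$ vertices. If $T^{*}$ contains a vertex $u$ of degree $2$, then one of the neighbors of $u$ is a pendent vertex (a vertex of degree $1$).
   Context: A chemical tree is a tree in which every vertex has degree at most $4$. For a vertex $v$ of a graph $G$, $d_v$ denotes its degree and $\tau_v$ denotes the number of vertices at distance exactly $2$ from $v$. The modified first Zagreb connection index is $ZC_{1}^{*}(G)=\sum_{v\in V(G)}d_{v}\tau_{v}$. -}

module Defs where

open import Data.Nat using (ℕ; zero; suc; _+_; _*_; _∸_; _≤_)
open import Data.Fin using (Fin; zero; suc; _≟_)
open import Data.Bool using (Bool; true; false; not; _∧_; _∨_; if_then_else_)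
open import Relation.Nullary.Decidable using (⌊_⌋)
open import Relation.Binary.PropositionalEquality using (_≡_)
open import Data.Product using (_×_)

record Graph (n : ℕ) : Set where
  field
    adj    : Fin n → Fin n → Bool
    sym    : ∀ i j → adj i j ≡ adj j i
    irrefl : ∀ i → adj i i ≡ false
open Graph public

count : ∀ {n} → (Fin n → Bool) → ℕ
count {zero}  f = 0
count {suc n} f = (if f zero then 1 else 0) + count (λ i → f (suc i))

anyV : ∀ {n} → (Fin n → Bool) → Bool
anyV {zero}  f = false
anyV {suc n} f = f zero ∨ anyV (λ i → f (suc i))

sumV : ∀ {n} → (Fin n → ℕ) → ℕ
sumV {zero}  f = 0
sumV {suc n} f = f zero + sumV (λ i → f (suc i))

deg : ∀ {n} → Graph n → Fin n → ℕ
deg G v = count (adj G v)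

dist2 : ∀ {n} → Graph n → Fin n → Fin n → Bool
dist2 G v w = not ⌊ v ≟ w ⌋ ∧ not (adj G v w) ∧ anyV (λ x → adj G v x ∧ adj G x w)

tau : ∀ {n} → Graph n → Fin n → ℕ
tau G v = count (dist2 G v)

ZC1* : ∀ {n} → Graph n → ℕ
ZC1* G = sumV (λ v → deg G v * tau G v)

data Walk {n : ℕ} (G : Graph n) : Fin n → Fin n → Set where
  here : ∀ {u} → Walk G u u
  step : ∀ {u w v} → adj G u w ≡ true → Walk G w v → Walk G u v

Connected : ∀ {n} → Graph n → Set
Connected G = ∀ u v → Walk G u v

-- a tree: connected graph with n − 1 edges (sum of degrees = 2(n − 1))
IsTree : ∀ {n} → Graph n → Set
IsTree {n} G = Connected G × (sumV (deg G) ≡ 2 * (n ∸ 1))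

IsChemicalTree : ∀ {n} → Graph n → Set
IsChemicalTree G = IsTree G × (∀ v → deg G v ≤ 4)

{-# OPTIONS --safe #-}

-- A tree has no 3- or 4-cycles, so every vertex at distance 2 from a is reached by exactly
-- one path a – x – b, and τ_a = Σ_{x∼a} (d_x − 1).  Hence ZC₁* = Σ_a d_a Σ_{x∼a} (d_x − 1)
-- on trees.
--
-- Let u have degree 2 and neighbours v, w, neither of them a leaf.  Remove u from the path
-- v – u – w, join v and w by an edge, and hang u as a pendant vertex on a vertex z: on z = v
-- if d_v ≤ 3 (symmetrically on w if d_w ≤ 3), and on a leaf z if d_v = d_w = 4.  The result
-- is again a chemical tree.  In the sum above only the summand of u can decrease, while
-- those of v and w grow by more than u loses, so ZC₁* strictly increases, contradicting
-- maximality.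

module Submission where

open import Defs renaming (sym to adj-comm)
open import Data.Bool using (Bool; true; false; not; _∧_; _∨_; if_then_else_)
open import Data.Bool.Properties using (∧-identityʳ; ∧-zeroʳ; ∨-identityʳ; ∨-zeroʳ; ∧-comm; ∨-comm)
open import Data.Empty using (⊥-elim)
open import Data.Fin using (Fin; zero; suc; _≟_)
import Data.Fin.Properties as Fin
open import Data.Nat using (ℕ; zero; suc; _+_; _*_; _∸_; _≤_; _<_; z≤n; s≤s)
import Data.Nat as ℕ
open import Data.Nat.Properties hiding (_≟_)
open import Data.Nat.Tactic.RingSolver using (solve-∀)
open import Algebra.Properties.CommutativeSemigroup +-commutativeSemigroup using (xy∙z≈xz∙y)
open import Algebra.Properties.Semiring.Sum +-*-semiring
  using (sum; ∑-comm; ∑-distrib-+; sum-cong-≗; sum-replicate-zero)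
open import Data.Product using (Σ; _×_; _,_; proj₁; proj₂; map; map₂)
open import Data.Sum using (_⊎_; inj₁; inj₂; swap)
open import Relation.Binary.PropositionalEquality
  using (_≡_; _≢_; ≢-sym; refl; sym; trans; cong; cong₂; subst; subst₂; module ≡-Reasoning)
open import Relation.Nullary using (Dec; yes; no; ¬_; does)
open import Relation.Nullary.Decidable using (dec-true; dec-false)

-- Finite sums and counts over Fin n

[_] : Bool → ℕ
[ b ] = if b then 1 else 0

𝟙 : ∀ {n} → Fin n → Fin n → ℕ
𝟙 p i = [ does (i ≟ p) ]

𝟙-same : ∀ {n} (p : Fin n) → 𝟙 p p ≡ 1
𝟙-same p = cong [_] (dec-true (p ≟ p) refl)

𝟙-other : ∀ {n} {p i : Fin n} → i ≢ p → 𝟙 p i ≡ 0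
𝟙-other {p = p} {i} i≢p = cong [_] (dec-false (i ≟ p) i≢p)

by-point : ∀ {n} {P : Fin n → Set} (p : Fin n) → P p → (∀ {x} → x ≢ p → P x) → ∀ x → P x
by-point p at-p elsewhere x with x ≟ p
... | yes refl = at-p
... | no x≢p   = elsewhere x≢p

sumV≡sum : ∀ {n} (f : Fin n → ℕ) → sumV f ≡ sum f
sumV≡sum {zero}  f = refl
sumV≡sum {suc n} f = cong (f zero +_) (sumV≡sum (λ i → f (suc i)))

count≡sum : ∀ {n} (f : Fin n → Bool) → count f ≡ sum (λ i → [ f i ])
count≡sum {zero}  f = refl
count≡sum {suc n} f = cong ([ f zero ] +_) (count≡sum (λ i → f (suc i)))

sum-const : ∀ n k → sum {n} (λ _ → k) ≡ n * k
sum-const zero    k = refl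
sum-const (suc n) k = cong (k +_) (sum-const n k)

sum-mono-≤ : ∀ {n} {f g : Fin n → ℕ} → (∀ i → f i ≤ g i) → sum f ≤ sum g
sum-mono-≤ {zero}  f≤g = z≤n
sum-mono-≤ {suc n} f≤g = +-mono-≤ (f≤g zero) (sum-mono-≤ (λ i → f≤g (suc i)))

≤-sum : ∀ {n} (f : Fin n → ℕ) p → f p ≤ sum f
≤-sum f zero    = m≤m+n (f zero) _
≤-sum f (suc p) = ≤-trans (≤-sum (λ i → f (suc i)) p) (m≤n+m _ (f zero))

sum-𝟙* : ∀ {n} (p : Fin n) (f : Fin n → ℕ) → sum (λ i → 𝟙 p i * f i) ≡ f p
sum-𝟙* {suc n} zero f =
  trans (cong₂ _+_ (*-identityˡ (f zero)) (sum-replicate-zero n)) (+-identityʳ (f zero))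
sum-𝟙* {suc n} (suc p) f = sum-𝟙* p (λ i → f (suc i))

δ : ∀ {n} → Fin n → ℕ → Fin n → ℕ
δ p k i = if does (i ≟ p) then k else 0

sum-δ : ∀ {n} (p : Fin n) k → sum (δ p k) ≡ k
sum-δ p k = trans (sum-cong-≗ δ≡𝟙*) (sum-𝟙* p (λ _ → k))
  where
  δ≡𝟙* : ∀ i → δ p k i ≡ 𝟙 p i * k
  δ≡𝟙* i with does (i ≟ p)
  ... | true  = sym (+-identityʳ k)
  ... | false = refl

sum-𝟙 : ∀ {n} (p : Fin n) → sum (𝟙 p) ≡ 1
sum-𝟙 p = sum-δ p 1

sum-+-mono-≤ : ∀ {n} {f g P Q : Fin n → ℕ} → (∀ i → f i + P i ≤ g i + Q i) →
               sum f + sum P ≤ sum g + sum Q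
sum-+-mono-≤ {f = f} {g} {P} {Q} h = begin
  sum f + sum P          ≡⟨ ∑-distrib-+ f P ⟨
  sum (λ i → f i + P i)  ≤⟨ sum-mono-≤ h ⟩
  sum (λ i → g i + Q i)  ≡⟨ ∑-distrib-+ g Q ⟩
  sum g + sum Q          ∎
  where open ≤-Reasoning

module _ {n} {f g : Fin n → ℕ} where

  sum-≡-except : ∀ p → (∀ {i} → i ≢ p → f i ≡ g i) → sum f + g p ≡ sum g + f p
  sum-≡-except p agree = begin
    sum f + g p                        ≡⟨ cong (sum f +_) (sum-𝟙* p g) ⟨
    sum f + sum (λ i → 𝟙 p i * g i)    ≡⟨ ∑-distrib-+ f (λ i → 𝟙 p i * g i) ⟨
    sum (λ i → f i + 𝟙 p i * g i)      ≡⟨ sum-cong-≗ pointwise ⟩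
    sum (λ i → g i + 𝟙 p i * f i)      ≡⟨ ∑-distrib-+ g (λ i → 𝟙 p i * f i) ⟩
    sum g + sum (λ i → 𝟙 p i * f i)    ≡⟨ cong (sum g +_) (sum-𝟙* p f) ⟩
    sum g + f p                        ∎
    where
    open ≡-Reasoning
    pointwise : ∀ i → f i + 𝟙 p i * g i ≡ g i + 𝟙 p i * f i
    pointwise i with i ≟ p
    ... | yes refl = trans (cong (f i +_) (*-identityˡ (g i)))
                      (trans (+-comm (f i) (g i)) (cong (g i +_) (sym (*-identityˡ (f i)))))
    ... | no i≢p   = cong (_+ 0) (agree i≢p)

  sum-≤-except₂ : ∀ {p q L A} → q ≢ p → f p ≤ g p + L → f q + A ≤ g q →
                  (∀ {i} → i ≢ p → i ≢ q → f i ≤ g i) → sum f + A ≤ sum g + L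
  sum-≤-except₂ {p} {q} {L} {A} q≢p at-p at-q elsewhere = begin
    sum f + A              ≡⟨ cong (sum f +_) (sum-δ q A) ⟨
    sum f + sum (δ q A)    ≤⟨ sum-+-mono-≤ pointwise ⟩
    sum g + sum (δ p L)    ≡⟨ cong (sum g +_) (sum-δ p L) ⟩
    sum g + L              ∎
    where
    open ≤-Reasoning
    pointwise : ∀ i → f i + δ q A i ≤ g i + δ p L i
    pointwise i with i ≟ p | i ≟ q
    ... | yes refl | yes p≡q  = ⊥-elim (q≢p (sym p≡q))
    ... | yes refl | no _     = subst (_≤ g p + L) (sym (+-identityʳ (f p))) at-p
    ... | no _     | yes refl = subst (f q + A ≤_) (sym (+-identityʳ (g q))) at-q
    ... | no i≢p   | no i≢q   = +-monoˡ-≤ 0 (elsewhere i≢p i≢q)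

  sum-<-except₃ : ∀ {p q r L A B} → q ≢ p → r ≢ p → r ≢ q →
                  f p ≤ g p + L → f q + A ≤ g q → f r + B ≤ g r →
                  (∀ {i} → i ≢ p → i ≢ q → i ≢ r → f i ≤ g i) → L < A + B → sum f < sum g
  sum-<-except₃ {p} {q} {r} {L} {A} {B} q≢p r≢p r≢q at-p at-q at-r elsewhere L<A+B =
    +-cancelʳ-< L (sum f) (sum g) (begin-strict
      sum f + L                                <⟨ +-monoʳ-< (sum f) L<A+B ⟩
      sum f + (A + B)                          ≡⟨ cong (sum f +_) (cong₂ _+_ (sum-δ q A) (sum-δ r B)) ⟨
      sum f + (sum (δ q A) + sum (δ r B))      ≡⟨ cong (sum f +_) (∑-distrib-+ (δ q A) (δ r B)) ⟨
      sum f + sum (λ i → δ q A i + δ r B i)    ≤⟨ sum-+-mono-≤ pointwise ⟩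
      sum g + sum (δ p L)                      ≡⟨ cong (sum g +_) (sum-δ p L) ⟩
      sum g + L                                ∎)
    where
    open ≤-Reasoning
    pointwise : ∀ i → f i + (δ q A i + δ r B i) ≤ g i + δ p L i
    pointwise i with i ≟ p | i ≟ q | i ≟ r
    ... | yes refl | yes p≡q  | _        = ⊥-elim (q≢p (sym p≡q))
    ... | yes refl | no _     | yes p≡r  = ⊥-elim (r≢p (sym p≡r))
    ... | no _     | yes refl | yes q≡r  = ⊥-elim (r≢q (sym q≡r))
    ... | yes refl | no _     | no _     = subst (_≤ g p + L) (sym (+-identityʳ (f p))) at-p
    ... | no _     | yes refl | no _     =
      subst₂ _≤_ (cong (f q +_) (sym (+-identityʳ A))) (sym (+-identityʳ (g q))) at-q
    ... | no _     | no _     | yes refl = subst (f r + B ≤_) (sym (+-identityʳ (g r))) at-r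
    ... | no i≢p   | no i≢q   | no i≢r   = +-monoˡ-≤ 0 (elsewhere i≢p i≢q i≢r)

∧-split : ∀ {p q} → p ∧ q ≡ true → p ≡ true × q ≡ true
∧-split {true} {true} _ = refl , refl

∨-split : ∀ {p q} → p ∨ q ≡ true → p ≡ true ⊎ q ≡ true
∨-split {true}  _ = inj₁ refl
∨-split {false} q = inj₂ q

does⇒≡ : ∀ {n} {x y : Fin n} → does (x ≟ y) ≡ true → x ≡ y
does⇒≡ {x = x} {y} d with x ≟ y | d
... | yes x≡y | _ = x≡y
... | no _    | ()

[∨]-disjoint : ∀ a b → a ∧ b ≡ false → [ a ∨ b ] ≡ [ a ] + [ b ]
[∨]-disjoint false b     _ = refl
[∨]-disjoint true  false _ = refl

[∧not]+[] : ∀ a b → (b ≡ true → a ≡ true) → [ a ∧ not b ] + [ b ] ≡ [ a ]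
[∧not]+[] a     false _   = trans (+-identityʳ [ a ∧ true ]) (cong [_] (∧-identityʳ a))
[∧not]+[] true  true  _   = refl
[∧not]+[] false true  b⇒a with b⇒a refl
... | ()

count-cong : ∀ {n} {f g : Fin n → Bool} → (∀ i → f i ≡ g i) → count f ≡ count g
count-cong {f = f} {g} f≗g =
  trans (count≡sum f) (trans (sum-cong-≗ (λ i → cong [_] (f≗g i))) (sym (count≡sum g)))

count-≟ : ∀ {n} (p : Fin n) → count (λ i → does (i ≟ p)) ≡ 1
count-≟ p = trans (count≡sum (λ i → does (i ≟ p))) (sum-𝟙 p)

count-witness : ∀ {n} (f : Fin n → Bool) → 0 < count f → Σ (Fin n) (λ i → f i ≡ true)
count-witness {suc n} f pos with f zero in f0
... | true  = zero , f0
... | false with count-witness (λ i → f (suc i)) pos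
...   | i , fi = suc i , fi

1≤count : ∀ {n} (f : Fin n → Bool) {i} → f i ≡ true → 1 ≤ count f
1≤count f {i} fi = begin
  1                    ≡⟨ cong [_] fi ⟨
  [ f i ]              ≤⟨ ≤-sum (λ j → [ f j ]) i ⟩
  sum (λ j → [ f j ])  ≡⟨ count≡sum f ⟨
  count f              ∎
  where open ≤-Reasoning

count≡0 : ∀ {n} (f : Fin n → Bool) → (∀ i → f i ≡ false) → count f ≡ 0
count≡0 {zero}  f none = refl
count≡0 {suc n} f none rewrite none zero = count≡0 (λ i → f (suc i)) (λ i → none (suc i))

count-remove : ∀ {n} (f : Fin n → Bool) {p} → f p ≡ true →
               count f ≡ suc (count (λ i → f i ∧ not (does (i ≟ p))))
count-remove f {p} fp = begin
  count f                                             ≡⟨ count≡sum f ⟩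
  sum (λ i → [ f i ])                                 ≡⟨ sum-cong-≗ split ⟨
  sum (λ i → [ f′ i ] + 𝟙 p i)                        ≡⟨ ∑-distrib-+ (λ i → [ f′ i ]) (𝟙 p) ⟩
  sum (λ i → [ f′ i ]) + sum (𝟙 p)                    ≡⟨ cong₂ _+_ (count≡sum f′) (sym (sum-𝟙 p)) ⟨
  count f′ + 1                                        ≡⟨ +-comm (count f′) 1 ⟩
  suc (count f′)                                      ∎
  where
  open ≡-Reasoning
  f′ = λ i → f i ∧ not (does (i ≟ p))
  split : ∀ i → [ f i ∧ not (does (i ≟ p)) ] + [ does (i ≟ p) ] ≡ [ f i ]
  split i with i ≟ p
  ... | yes refl = [∧not]+[] (f i) true (λ _ → fp)
  ... | no _     = [∧not]+[] (f i) false λ ()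

anyV-intro : ∀ {n} (f : Fin n → Bool) {i} → f i ≡ true → anyV f ≡ true
anyV-intro f {zero}  fi rewrite fi = refl
anyV-intro f {suc i} fi with f zero
... | true  = refl
... | false = anyV-intro (λ j → f (suc j)) fi

anyV-witness : ∀ {n} (f : Fin n → Bool) → anyV f ≡ true → Σ (Fin n) (λ i → f i ≡ true)
anyV-witness {suc n} f any with f zero in f0
... | true  = zero , f0
... | false with anyV-witness (λ i → f (suc i)) any
...   | i , fi = suc i , fi

count≡[anyV] : ∀ {n} (f : Fin n → Bool) → (∀ i j → f i ≡ true → f j ≡ true → i ≡ j) →
               count f ≡ [ anyV f ]
count≡[anyV] {zero}  f unique = refl
count≡[anyV] {suc n} f unique with f zero in f0
... | true  = cong suc (count≡0 (λ i → f (suc i)) rest-false)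
  where
  rest-false : ∀ i → f (suc i) ≡ false
  rest-false i with f (suc i) in fi
  ... | false = refl
  ... | true with unique zero (suc i) f0 fi
  ...   | ()
... | false =
  count≡[anyV] (λ i → f (suc i)) (λ i j fi fj → Fin.suc-injective (unique (suc i) (suc j) fi fj))

-- Graphs, walks and edge deletion

adj-sym : ∀ {n} (G : Graph n) {x y} → adj G x y ≡ true → adj G y x ≡ true
adj-sym G {x} {y} xy = trans (adj-comm G y x) xy

adj⇒≢ : ∀ {n} (G : Graph n) {x y} → adj G x y ≡ true → x ≢ y
adj⇒≢ G {x} xx refl with trans (sym xx) (irrefl G x)
... | ()

2≤deg-non-leaf : ∀ {n} (G : Graph n) {x y} → adj G x y ≡ true → deg G y ≢ 1 → 2 ≤ deg G y
2≤deg-non-leaf G {x} {y} x~y deg≢1 = ≤∧≢⇒< (1≤count (adj G y) (adj-sym G x~y)) (≢-sym deg≢1)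

deg-≢ : ∀ {n} {G : Graph n} {x y a b} → deg G x ≡ a → deg G y ≡ b → a ≢ b → x ≢ y
deg-≢ deg-x deg-y a≢b refl = a≢b (trans (sym deg-x) deg-y)

_++ʷ_ : ∀ {n} {G : Graph n} {a b c} → Walk G a b → Walk G b c → Walk G a c
here      ++ʷ q = q
step e p  ++ʷ q = step e (p ++ʷ q)

reverseʷ : ∀ {n} {G : Graph n} {a b} → Walk G a b → Walk G b a
reverseʷ here              = here
reverseʷ {G = G} (step e p) = reverseʷ p ++ʷ step (adj-sym G e) here

mapʷ : ∀ {n} {G H : Graph n} → (∀ {x y} → adj G x y ≡ true → Walk H x y) →
       ∀ {a b} → Walk G a b → Walk H a b
mapʷ f here       = here
mapʷ f (step e p) = f e ++ʷ mapʷ f p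

joins : ∀ {n} → Fin n → Fin n → Fin n → Fin n → Bool
joins a b x y = (does (x ≟ a) ∧ does (y ≟ b)) ∨ (does (x ≟ b) ∧ does (y ≟ a))

module _ {n} {a b : Fin n} where

  joins-comm : ∀ x y → joins a b x y ≡ joins a b y x
  joins-comm x y = trans (∨-comm (does (x ≟ a) ∧ does (y ≟ b)) _)
    (cong₂ _∨_ (∧-comm (does (x ≟ b)) (does (y ≟ a))) (∧-comm (does (x ≟ a)) (does (y ≟ b))))

  joins-away : ∀ {x} y → x ≢ a → x ≢ b → joins a b x y ≡ false
  joins-away {x} y x≢a x≢b rewrite dec-false (x ≟ a) x≢a | dec-false (x ≟ b) x≢b = refl

  joins-left : a ≢ b → ∀ y → joins a b a y ≡ does (y ≟ b)
  joins-left a≢b y rewrite dec-true (a ≟ a) refl | dec-false (a ≟ b) a≢b = ∨-identityʳ _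

  joins-right : a ≢ b → ∀ y → joins a b b y ≡ does (y ≟ a)
  joins-right a≢b y rewrite dec-false (b ≟ a) (λ b≡a → a≢b (sym b≡a)) | dec-true (b ≟ b) refl = refl

  joins⇒ : ∀ {x y} → joins a b x y ≡ true → (x ≡ a × y ≡ b) ⊎ (x ≡ b × y ≡ a)
  joins⇒ j with ∨-split j
  ... | inj₁ xa∧yb = inj₁ (map does⇒≡ does⇒≡ (∧-split xa∧yb))
  ... | inj₂ xb∧ya = inj₂ (map does⇒≡ does⇒≡ (∧-split xb∧ya))

  joins-irrefl : a ≢ b → ∀ x → joins a b x x ≡ false
  joins-irrefl a≢b x with x ≟ a | x ≟ b
  ... | yes refl | yes refl = ⊥-elim (a≢b refl)
  ... | yes _    | no _     = refl
  ... | no _     | yes _    = refl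
  ... | no _     | no _     = refl

  count-joins : a ≢ b → ∀ x → count (joins a b x) ≡ 𝟙 a x + 𝟙 b x
  count-joins a≢b x = by-cases (x ≟ a) (x ≟ b)
    where
    by-cases : Dec (x ≡ a) → Dec (x ≡ b) → count (joins a b x) ≡ 𝟙 a x + 𝟙 b x
    by-cases (yes refl) _ = begin
      count (joins a b a)  ≡⟨ trans (count-cong (joins-left a≢b)) (count-≟ b) ⟩
      1 + 0                ≡⟨ cong₂ _+_ (𝟙-same a) (𝟙-other a≢b) ⟨
      𝟙 a a + 𝟙 b a        ∎
      where open ≡-Reasoning
    by-cases (no x≢a) (yes refl) = begin
      count (joins a b b)  ≡⟨ trans (count-cong (joins-right a≢b)) (count-≟ a) ⟩
      0 + 1                ≡⟨ cong₂ _+_ (𝟙-other x≢a) (𝟙-same b) ⟨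
      𝟙 a b + 𝟙 b b        ∎
      where open ≡-Reasoning
    by-cases (no x≢a) (no x≢b) = begin
      count (joins a b x)  ≡⟨ count≡0 _ (λ y → joins-away y x≢a x≢b) ⟩
      0 + 0                ≡⟨ cong₂ _+_ (𝟙-other x≢a) (𝟙-other x≢b) ⟨
      𝟙 a x + 𝟙 b x        ∎
      where open ≡-Reasoning

deleteEdge : ∀ {n} → Graph n → Fin n → Fin n → Graph n
deleteEdge G a b = record
  { adj    = λ x y → adj G x y ∧ not (joins a b x y)
  ; sym    = λ x y → cong₂ (λ p q → p ∧ not q) (adj-comm G x y) (joins-comm x y)
  ; irrefl = λ x → cong (λ p → p ∧ not (joins a b x x)) (irrefl G x)
  }

adj-deleteEdge : ∀ {n} (G : Graph n) {a b x y} → joins a b x y ≡ false →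
                 adj (deleteEdge G a b) x y ≡ adj G x y
adj-deleteEdge G {x = x} {y} j = trans (cong (λ q → adj G x y ∧ not q) j) (∧-identityʳ (adj G x y))

module _ {n} (G : Graph n) {a b : Fin n} (a~b : adj G a b ≡ true) where

  private
    joins⇒adj : ∀ {x y} → joins a b x y ≡ true → adj G x y ≡ true
    joins⇒adj {x} {y} j with joins⇒ {a = a} {b = b} {x} {y} j
    ... | inj₁ (refl , refl) = a~b
    ... | inj₂ (refl , refl) = adj-sym G a~b

  deg-deleteEdge : ∀ x → deg (deleteEdge G a b) x + (𝟙 a x + 𝟙 b x) ≡ deg G x
  deg-deleteEdge x = begin
    deg (deleteEdge G a b) x + (𝟙 a x + 𝟙 b x)
      ≡⟨ cong (deg (deleteEdge G a b) x +_) (count-joins (adj⇒≢ G a~b) x) ⟨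
    count (λ y → adj G x y ∧ not (joins a b x y)) + count (joins a b x)
      ≡⟨ cong₂ _+_ (count≡sum (λ y → adj G x y ∧ not (joins a b x y))) (count≡sum (joins a b x)) ⟩
    sum (λ y → [ adj G x y ∧ not (joins a b x y) ]) + sum (λ y → [ joins a b x y ])
      ≡⟨ ∑-distrib-+ (λ y → [ adj G x y ∧ not (joins a b x y) ]) _ ⟨
    sum (λ y → [ adj G x y ∧ not (joins a b x y) ] + [ joins a b x y ])
      ≡⟨ sum-cong-≗ (λ y → [∧not]+[] (adj G x y) (joins a b x y) joins⇒adj) ⟩
    sum (λ y → [ adj G x y ])
      ≡⟨ count≡sum (adj G x) ⟨
    deg G x ∎
    where open ≡-Reasoning

  sumDeg-deleteEdge : sumV (deg (deleteEdge G a b)) + 2 ≡ sumV (deg G)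
  sumDeg-deleteEdge = begin
    sumV (deg (deleteEdge G a b)) + 2
      ≡⟨ cong₂ _+_ (sumV≡sum (deg (deleteEdge G a b))) (sym (cong₂ _+_ (sum-𝟙 a) (sum-𝟙 b))) ⟩
    sum (deg (deleteEdge G a b)) + (sum (𝟙 a) + sum (𝟙 b))
      ≡⟨ cong (sum (deg (deleteEdge G a b)) +_) (∑-distrib-+ (𝟙 a) (𝟙 b)) ⟨
    sum (deg (deleteEdge G a b)) + sum (λ x → 𝟙 a x + 𝟙 b x)
      ≡⟨ ∑-distrib-+ (deg (deleteEdge G a b)) _ ⟨
    sum (λ x → deg (deleteEdge G a b) x + (𝟙 a x + 𝟙 b x))
      ≡⟨ sum-cong-≗ deg-deleteEdge ⟩
    sum (deg G)
      ≡⟨ sumV≡sum (deg G) ⟨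
    sumV (deg G) ∎
    where open ≡-Reasoning

-- Connected graphs

reach : ∀ {n} → Graph n → Fin n → ℕ → Fin n → Bool
reach G r zero    x = does (x ≟ r)
reach G r (suc k) x = reach G r k x ∨ anyV (λ y → adj G x y ∧ reach G r k y)

walk⇒reach : ∀ {n} {G : Graph n} {x r} → Walk G x r → Σ ℕ (λ k → reach G r k x ≡ true)
walk⇒reach {r = r} here = 0 , dec-true (r ≟ r) refl
walk⇒reach {G = G} {x} {r} (step {w = y} x~y p) with walk⇒reach p
... | k , reach-y = suc k , trans (cong (reach G r k x ∨_) via-y) (∨-zeroʳ _)
  where
  via-y : anyV (λ z → adj G x z ∧ reach G r k z) ≡ true
  via-y = anyV-intro (λ z → adj G x z ∧ reach G r k z) (cong₂ _∧_ x~y reach-y)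

least-witness : (P : ℕ → Bool) (k : ℕ) → P k ≡ true →
                Σ ℕ (λ m → P m ≡ true × (∀ j → j < m → P j ≡ false))
least-witness P zero    Pk = 0 , Pk , λ _ ()
least-witness P (suc k) Pk with P zero in P0
... | true  = 0 , P0 , λ _ ()
... | false with least-witness (λ i → P (suc i)) k Pk
...   | m , Pm , below = suc m , Pm , λ { zero _ → P0 ; (suc j) (s≤s j<m) → below j j<m }

module Levels {n} (G : Graph n) (connected : Connected G) (r : Fin n) where

  private
    minimal-reach : ∀ x → Σ ℕ (λ m → reach G r m x ≡ true × (∀ j → j < m → reach G r j x ≡ false))
    minimal-reach x = least-witness (λ k → reach G r k x) (proj₁ reaches) (proj₂ reaches)
      where reaches = walk⇒reach (connected x r)

    reach-step : ∀ {j x} → reach G r j x ≡ false → reach G r (suc j) x ≡ true →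
                 Σ (Fin n) (λ y → adj G x y ≡ true × reach G r j y ≡ true)
    reach-step {j} {x} not-yet now =
      map₂ ∧-split (anyV-witness next (subst (λ p → p ∨ anyV next ≡ true) not-yet now))
      where
      next = λ y → adj G x y ∧ reach G r j y

  level : Fin n → ℕ
  level x = proj₁ (minimal-reach x)

  level-≤ : ∀ {x j} → reach G r j x ≡ true → level x ≤ j
  level-≤ {x} {j} reach-j with level x ≤? j
  ... | yes ≤j = ≤j
  ... | no  ≰j with trans (sym reach-j) (proj₂ (proj₂ (minimal-reach x)) j (≰⇒> ≰j))
  ...   | ()

  level-descent : ∀ {x} → x ≢ r → Σ (Fin n) (λ y → adj G x y ≡ true × level y < level x)
  level-descent {x} x≢r with minimal-reach x
  ... | zero  , reach-0 , _     = ⊥-elim (x≢r (does⇒≡ reach-0))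
  ... | suc j , reach-m , below with reach-step {j} (below j ≤-refl) reach-m
  ...   | y , x~y , reach-y = y , x~y , s≤s (level-≤ {j = j} reach-y)

  descends : Fin n → Fin n → Bool
  descends a b = adj G a b ∧ does (level b <? level a)

  descents : ℕ
  descents = sum (λ a → sum (λ b → [ descends a b ]))

  descends-antisym : ∀ a b → [ descends a b ] + [ descends b a ] ≤ [ adj G a b ]
  descends-antisym a b =
    subst (λ q → [ descends a b ] + [ q ∧ does (level a <? level b) ] ≤ [ adj G a b ]) (adj-comm G a b)
      (one-way (adj G a b) (level b <? level a) (level a <? level b))
    where
    one-way : ∀ p {m k} (m<k? : Dec (m < k)) (k<m? : Dec (k < m)) →
              [ p ∧ does m<k? ] + [ p ∧ does k<m? ] ≤ [ p ]
    one-way false _         _         = z≤n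
    one-way true  (yes m<k) (yes k<m) = ⊥-elim (<-asym m<k k<m)
    one-way true  (yes _)   (no _)    = ≤-refl
    one-way true  (no _)    (yes _)   = ≤-refl
    one-way true  (no _)    (no _)    = z≤n

  descents+descents≤sumDeg : descents + descents ≤ sumV (deg G)
  descents+descents≤sumDeg = begin
    descents + descents
      ≡⟨ cong (descents +_) (∑-comm (λ b a → [ descends b a ])) ⟩
    descents + sum (λ a → sum (λ b → [ descends b a ]))
      ≡⟨ ∑-distrib-+ (λ a → sum (λ b → [ descends a b ])) (λ a → sum (λ b → [ descends b a ])) ⟨
    sum (λ a → sum (λ b → [ descends a b ]) + sum (λ b → [ descends b a ]))
      ≡⟨ sum-cong-≗ (λ a → ∑-distrib-+ (λ b → [ descends a b ]) (λ b → [ descends b a ])) ⟨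
    sum (λ a → sum (λ b → [ descends a b ] + [ descends b a ]))
      ≤⟨ sum-mono-≤ (λ a → sum-mono-≤ (descends-antisym a)) ⟩
    sum (λ a → sum (λ b → [ adj G a b ]))
      ≡⟨ sum-cong-≗ (λ a → count≡sum (adj G a)) ⟨
    sum (deg G)
      ≡⟨ sumV≡sum (deg G) ⟨
    sumV (deg G) ∎
    where open ≤-Reasoning

  n≤descents+1 : n ≤ descents + 1
  n≤descents+1 = begin
    n
      ≡⟨ trans (sym (*-identityʳ n)) (sym (sum-const n 1)) ⟩
    sum {n} (λ _ → 1)
      ≤⟨ sum-mono-≤ root-or-descends ⟩
    sum (λ a → sum (λ b → [ descends a b ]) + 𝟙 r a)
      ≡⟨ ∑-distrib-+ (λ a → sum (λ b → [ descends a b ])) (𝟙 r) ⟩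
    descents + sum (𝟙 r)
      ≡⟨ cong (descents +_) (sum-𝟙 r) ⟩
    descents + 1 ∎
    where
    open ≤-Reasoning
    root-or-descends : ∀ a → 1 ≤ sum (λ b → [ descends a b ]) + 𝟙 r a
    root-or-descends a = by-cases (a ≟ r)
      where
      by-cases : Dec (a ≡ r) → 1 ≤ sum (λ b → [ descends a b ]) + 𝟙 r a
      by-cases (yes refl) =
        ≤-trans (≤-reflexive (sym (𝟙-same r))) (m≤n+m (𝟙 r r) (sum (λ b → [ descends r b ])))
      by-cases (no a≢r) with level-descent a≢r
      ... | y , a~y , y<a = begin
        1                                     ≤⟨ 1≤count (descends a) a↘y ⟩
        count (descends a)                    ≡⟨ count≡sum (descends a) ⟩
        sum (λ b → [ descends a b ])          ≤⟨ m≤m+n _ (𝟙 r a) ⟩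
        sum (λ b → [ descends a b ]) + 𝟙 r a  ∎
        where
        a↘y : descends a y ≡ true
        a↘y = cong₂ _∧_ a~y (dec-true (level y <? level a) y<a)

-- Every vertex except the root has a neighbour of smaller level, and an edge descends in at
-- most one direction, so a connected graph has at least n − 1 edges.
connected⇒2n≤sumDeg+2 : ∀ {n} (G : Graph n) → Connected G → 2 * n ≤ sumV (deg G) + 2
connected⇒2n≤sumDeg+2 {zero}  G connected = z≤n
connected⇒2n≤sumDeg+2 {suc m} G connected = begin
  2 * suc m                  ≤⟨ *-monoʳ-≤ 2 n≤descents+1 ⟩
  2 * (descents + 1)         ≡⟨ double descents ⟩
  descents + descents + 2    ≤⟨ +-monoˡ-≤ 2 descents+descents≤sumDeg ⟩
  sumV (deg G) + 2           ∎
  where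
  open ≤-Reasoning
  open Levels G connected zero
  double : ∀ x → 2 * (x + 1) ≡ x + x + 2
  double = solve-∀

connected⇒1≤deg : ∀ {n} {G : Graph n} → Connected G → ∀ {x y} → x ≢ y → 1 ≤ deg G x
connected⇒1≤deg {G = G} connected {x} {y} x≢y with connected x y
... | here       = ⊥-elim (x≢y refl)
... | step x~z _ = 1≤count (adj G x) x~z

-- Trees

-- Otherwise deleting the edge would leave a connected graph with n − 2 edges.
tree-edge-is-bridge : ∀ {n} {G : Graph n} → IsTree G → ∀ {a b} → adj G a b ≡ true →
                      ¬ Walk (deleteEdge G a b) a b
tree-edge-is-bridge {suc k} {G} (connected , sumDeg) {a} {b} a~b W =
  1+n≰n (*-cancelˡ-≤ 2 too-few-edges)
  where
  G′ = deleteEdge G a b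

  reroute : ∀ {x y} → adj G x y ≡ true → Walk G′ x y
  reroute {x} {y} x~y with joins a b x y in j
  ... | false = step (trans (adj-deleteEdge G j) x~y) here
  ... | true with joins⇒ {a = a} {b = b} {x} {y} j
  ...   | inj₁ (refl , refl) = W
  ...   | inj₂ (refl , refl) = reverseʷ W

  too-few-edges : 2 * suc k ≤ 2 * k
  too-few-edges = begin
    2 * suc k             ≤⟨ connected⇒2n≤sumDeg+2 G′ (λ x y → mapʷ reroute (connected x y)) ⟩
    sumV (deg G′) + 2     ≡⟨ sumDeg-deleteEdge G a~b ⟩
    sumV (deg G)          ≡⟨ sumDeg ⟩
    2 * k                 ∎
    where open ≤-Reasoning

tree-has-leaf : ∀ {n} {G : Graph n} → IsTree G → ∀ {x y : Fin n} → x ≢ y →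
                Σ (Fin n) λ ℓ → deg G ℓ ≡ 1
tree-has-leaf {suc k} {G} (connected , sumDeg) {x} {y} x≢y with Fin.any? (λ a → deg G a ≤? 1)
... | yes (ℓ , ℓ≤1) = ℓ , ≤-antisym ℓ≤1 (by-point {P = λ a → 1 ≤ deg G a} x
                                              (connected⇒1≤deg connected x≢y)
                                              (connected⇒1≤deg connected) ℓ)
... | no  no-leaf    = ⊥-elim (1+n≰n (*-cancelˡ-≤ 2 (begin
  2 * suc k              ≡⟨ *-comm 2 (suc k) ⟩
  suc k * 2              ≡⟨ sum-const (suc k) 2 ⟨
  sum {suc k} (λ _ → 2)  ≤⟨ sum-mono-≤ (λ a → ≰⇒> (λ a≤1 → no-leaf (a , a≤1))) ⟩
  sum (deg G)            ≡⟨ sumV≡sum (deg G) ⟨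
  sumV (deg G)           ≡⟨ sumDeg ⟩
  2 * k                  ∎)))
  where open ≤-Reasoning

twoPathsVia : ∀ {n} → Graph n → Fin n → Fin n → ℕ
twoPathsVia G a x = [ adj G a x ] * (deg G x ∸ 1)

twoPaths : ∀ {n} → Graph n → Fin n → ℕ
twoPaths G a = sum (twoPathsVia G a)

ZC1*-term : ∀ {n} → Graph n → Fin n → ℕ
ZC1*-term G a = deg G a * twoPaths G a

twoPathsVia-mono : ∀ {n} {G H : Graph n} {a x} → adj H a x ≡ adj G a x → deg G x ≤ deg H x →
                   twoPathsVia G a x ≤ twoPathsVia H a x
twoPathsVia-mono {G = G} {a = a} {x} same-adj deg≤ rewrite same-adj =
  *-monoʳ-≤ [ adj G a x ] (∸-monoˡ-≤ 1 deg≤)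

module _ {n} {G : Graph n} (tree : IsTree G) where

  tree-triangle-free : ∀ {a x b} → adj G a x ≡ true → adj G x b ≡ true → adj G a b ≡ false
  tree-triangle-free {a} {x} {b} a~x x~b with adj G a b in a~b
  ... | false = refl
  ... | true  = ⊥-elim (tree-edge-is-bridge tree a~b (step a~′x (step x~′b here)))
    where
    a≢b = adj⇒≢ G a~b
    a~′x : adj (deleteEdge G a b) a x ≡ true
    a~′x = trans (adj-deleteEdge G (trans (joins-left a≢b x) (dec-false (x ≟ b) (adj⇒≢ G x~b)))) a~x
    x~′b : adj (deleteEdge G a b) x b ≡ true
    x~′b = trans (adj-deleteEdge G (joins-away b (≢-sym (adj⇒≢ G a~x)) (adj⇒≢ G x~b))) x~b

  tree-4-cycle-free : ∀ {a b x y} → a ≢ b → adj G a x ≡ true → adj G x b ≡ true →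
                      adj G a y ≡ true → adj G y b ≡ true → x ≡ y
  tree-4-cycle-free {a} {b} {x} {y} a≢b a~x x~b a~y y~b with x ≟ y
  ... | yes x≡y = x≡y
  ... | no  x≢y = ⊥-elim (tree-edge-is-bridge tree a~x (step a~′y (step y~′b (step b~′x here))))
    where
    y≢x = ≢-sym x≢y
    a~′y : adj (deleteEdge G a x) a y ≡ true
    a~′y = trans (adj-deleteEdge G (trans (joins-left (adj⇒≢ G a~x) y) (dec-false (y ≟ x) y≢x))) a~y
    y~′b : adj (deleteEdge G a x) y b ≡ true
    y~′b = trans (adj-deleteEdge G (joins-away b (≢-sym (adj⇒≢ G a~y)) y≢x)) y~b
    b~′x : adj (deleteEdge G a x) b x ≡ true
    b~′x = trans (adj-deleteEdge G (joins-away x (≢-sym a≢b) (≢-sym (adj⇒≢ G x~b)))) (adj-sym G x~b)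

  private
    twoPathsVia-as-sum : ∀ a x →
      twoPathsVia G a x ≡ sum (λ b → [ adj G a x ∧ (adj G x b ∧ not (does (b ≟ a))) ])
    twoPathsVia-as-sum a x with adj G a x in a~x
    ... | true  = begin
      1 * (deg G x ∸ 1)
        ≡⟨ *-identityˡ _ ⟩
      deg G x ∸ 1
        ≡⟨ cong (_∸ 1) (count-remove (adj G x) (adj-sym G a~x)) ⟩
      count (λ b → adj G x b ∧ not (does (b ≟ a)))
        ≡⟨ count≡sum (λ b → adj G x b ∧ not (does (b ≟ a))) ⟩
      sum (λ b → [ adj G x b ∧ not (does (b ≟ a)) ]) ∎
      where open ≡-Reasoning
    ... | false = sym (sum-replicate-zero n)

    dist2-irrefl : ∀ a → dist2 G a a ≡ false
    dist2-irrefl a with a ≟ a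
    ... | yes _   = refl
    ... | no a≢a  = ⊥-elim (a≢a refl)

    dist2≡anyV : ∀ {a b} → a ≢ b → dist2 G a b ≡ anyV (λ x → adj G a x ∧ adj G x b)
    dist2≡anyV {a} {b} a≢b with a ≟ b
    ... | yes a≡b = ⊥-elim (a≢b a≡b)
    ... | no _ with anyV (λ x → adj G a x ∧ adj G x b) in common
    ...   | false = ∧-zeroʳ (not (adj G a b))
    ...   | true with anyV-witness (λ x → adj G a x ∧ adj G x b) common
    ...     | x , a~x∧x~b with ∧-split a~x∧x~b
    ...       | a~x , x~b rewrite tree-triangle-free {a} {x} {b} a~x x~b = refl

    paths≡[dist2] : ∀ a b →
      sum (λ x → [ adj G a x ∧ (adj G x b ∧ not (does (b ≟ a))) ]) ≡ [ dist2 G a b ]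
    paths≡[dist2] a b with b ≟ a
    ... | yes refl = begin
      sum (λ x → [ adj G b x ∧ (adj G x b ∧ false) ])
        ≡⟨ sum-cong-≗ (λ x → cong [_] (trans (cong (adj G b x ∧_) (∧-zeroʳ _)) (∧-zeroʳ _))) ⟩
      sum {n} (λ _ → 0)
        ≡⟨ sum-replicate-zero n ⟩
      0
        ≡⟨ cong [_] (dist2-irrefl b) ⟨
      [ dist2 G b b ] ∎
      where open ≡-Reasoning
    ... | no b≢a = begin
      sum (λ x → [ adj G a x ∧ (adj G x b ∧ true) ])
        ≡⟨ sum-cong-≗ (λ x → cong (λ q → [ adj G a x ∧ q ]) (∧-identityʳ _)) ⟩
      sum (λ x → [ common x ])
        ≡⟨ count≡sum common ⟨
      count common
        ≡⟨ count≡[anyV] common at-most-one ⟩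
      [ anyV common ]
        ≡⟨ cong [_] (dist2≡anyV (≢-sym b≢a)) ⟨
      [ dist2 G a b ] ∎
      where
      open ≡-Reasoning
      common = λ x → adj G a x ∧ adj G x b
      at-most-one : ∀ x y → common x ≡ true → common y ≡ true → x ≡ y
      at-most-one x y cx cy with ∧-split cx | ∧-split cy
      ... | a~x , x~b | a~y , y~b = tree-4-cycle-free (≢-sym b≢a) a~x x~b a~y y~b

  tau≡twoPaths : ∀ a → tau G a ≡ twoPaths G a
  tau≡twoPaths a = sym (begin
    sum (twoPathsVia G a)
      ≡⟨ sum-cong-≗ (twoPathsVia-as-sum a) ⟩
    sum (λ x → sum (λ b → [ adj G a x ∧ (adj G x b ∧ not (does (b ≟ a))) ]))
      ≡⟨ ∑-comm (λ x b → [ adj G a x ∧ (adj G x b ∧ not (does (b ≟ a))) ]) ⟩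
    sum (λ b → sum (λ x → [ adj G a x ∧ (adj G x b ∧ not (does (b ≟ a))) ]))
      ≡⟨ sum-cong-≗ (paths≡[dist2] a) ⟩
    sum (λ b → [ dist2 G a b ])
      ≡⟨ count≡sum (dist2 G a) ⟨
    tau G a ∎)
    where open ≡-Reasoning

  ZC1*-tree : ZC1* G ≡ sum (ZC1*-term G)
  ZC1*-tree =
    trans (sumV≡sum (λ a → deg G a * tau G a)) (sum-cong-≗ (λ a → cong (deg G a *_) (tau≡twoPaths a)))

-- Vertices of degree 2

record Neighbours {n} (G : Graph n) (u v w : Fin n) : Set where
  field
    v≢w  : v ≢ w
    u~v  : adj G u v ≡ true
    u~w  : adj G u w ≡ true
    only : ∀ {y} → adj G u y ≡ true → y ≡ v ⊎ y ≡ w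

neighbours-swap : ∀ {n} {G : Graph n} {u v w} → Neighbours G u v w → Neighbours G u w v
neighbours-swap N = record
  { v≢w = ≢-sym v≢w ; u~v = u~w ; u~w = u~v ; only = λ u~y → swap (only u~y) }
  where open Neighbours N

deg≡2⇒neighbours : ∀ {n} (G : Graph n) {u} → deg G u ≡ 2 →
                   Σ (Fin n) λ v → Σ (Fin n) λ w → Neighbours G u v w
deg≡2⇒neighbours {n} G {u} deg≡2 =
  v , w , record { v≢w = ≢-sym w≢v ; u~v = u~v ; u~w = u~w ; only = only }
  where
  first = count-witness (adj G u) (subst (0 <_) (sym deg≡2) (s≤s z≤n))
  v = proj₁ first
  u~v = proj₂ first
  f₁ = λ y → adj G u y ∧ not (does (y ≟ v))
  count-f₁ : count f₁ ≡ 1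
  count-f₁ = suc-injective (trans (sym (count-remove (adj G u) u~v)) deg≡2)
  second = count-witness f₁ (subst (0 <_) (sym count-f₁) (s≤s z≤n))
  w = proj₁ second
  u~w = proj₁ (∧-split (proj₂ second))
  w≢v : w ≢ v
  w≢v w≡v with trans (sym (cong not (dec-true (w ≟ v) w≡v))) (proj₂ (∧-split (proj₂ second)))
  ... | ()
  f₂ = λ y → f₁ y ∧ not (does (y ≟ w))
  count-f₂ : count f₂ ≡ 0
  count-f₂ = suc-injective (trans (sym (count-remove f₁ (proj₂ second))) count-f₁)
  only : ∀ {y} → adj G u y ≡ true → y ≡ v ⊎ y ≡ w
  only {y} u~y with y ≟ v | y ≟ w
  ... | yes y≡v | _       = inj₁ y≡v
  ... | no _    | yes y≡w = inj₂ y≡w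
  ... | no y≢v  | no y≢w  = ⊥-elim (1+n≰n (subst (1 ≤_) count-f₂ (1≤count f₂ f₂-y)))
    where
    f₂-y : f₂ y ≡ true
    f₂-y rewrite u~y | dec-false (y ≟ v) y≢v | dec-false (y ≟ w) y≢w = refl

module _ {n} {G : Graph n} {u v w} (N : Neighbours G u v w) where
  open Neighbours N

  ¬adj-centre : ∀ {x} → x ≢ v → x ≢ w → adj G x u ≡ false
  ¬adj-centre {x} x≢v x≢w with adj G x u in x~u
  ... | false = refl
  ... | true with only (adj-sym G x~u)
  ...   | inj₁ x≡v = ⊥-elim (x≢v x≡v)
  ...   | inj₂ x≡w = ⊥-elim (x≢w x≡w)

  [adj-centre] : ∀ x → [ adj G u x ] ≡ 𝟙 v x + 𝟙 w x
  [adj-centre] x with x ≟ v | x ≟ w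
  ... | yes refl | yes refl = ⊥-elim (v≢w refl)
  ... | yes refl | no _     = cong [_] u~v
  ... | no _     | yes refl = cong [_] u~w
  ... | no x≢v   | no x≢w   = cong [_] (trans (adj-comm G u x) (¬adj-centre x≢v x≢w))

  deg-centre : deg G u ≡ 2
  deg-centre = begin
    deg G u                           ≡⟨ count≡sum (adj G u) ⟩
    sum (λ x → [ adj G u x ])         ≡⟨ sum-cong-≗ [adj-centre] ⟩
    sum (λ x → 𝟙 v x + 𝟙 w x)         ≡⟨ ∑-distrib-+ (𝟙 v) (𝟙 w) ⟩
    sum (𝟙 v) + sum (𝟙 w)             ≡⟨ cong₂ _+_ (sum-𝟙 v) (sum-𝟙 w) ⟩
    2                                 ∎
    where open ≡-Reasoning

  twoPaths-centre : twoPaths G u ≡ (deg G v ∸ 1) + (deg G w ∸ 1)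
  twoPaths-centre = begin
    sum (λ x → [ adj G u x ] * (deg G x ∸ 1))
      ≡⟨ sum-cong-≗ (λ x → cong (_* (deg G x ∸ 1)) ([adj-centre] x)) ⟩
    sum (λ x → (𝟙 v x + 𝟙 w x) * (deg G x ∸ 1))
      ≡⟨ sum-cong-≗ (λ x → *-distribʳ-+ (deg G x ∸ 1) (𝟙 v x) (𝟙 w x)) ⟩
    sum (λ x → 𝟙 v x * (deg G x ∸ 1) + 𝟙 w x * (deg G x ∸ 1))
      ≡⟨ ∑-distrib-+ (λ x → 𝟙 v x * (deg G x ∸ 1)) (λ x → 𝟙 w x * (deg G x ∸ 1)) ⟩
    sum (λ x → 𝟙 v x * (deg G x ∸ 1)) + sum (λ x → 𝟙 w x * (deg G x ∸ 1))
      ≡⟨ cong₂ _+_ (sum-𝟙* v (λ x → deg G x ∸ 1)) (sum-𝟙* w (λ x → deg G x ∸ 1)) ⟩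
    (deg G v ∸ 1) + (deg G w ∸ 1) ∎
    where open ≡-Reasoning

  ZC1*-term-centre : ZC1*-term G u ≡ 2 * ((deg G v ∸ 1) + (deg G w ∸ 1))
  ZC1*-term-centre = cong₂ _*_ deg-centre twoPaths-centre

  1≤twoPaths-neighbour : ∀ {a} → adj G u a ≡ true → 1 ≤ twoPaths G a
  1≤twoPaths-neighbour {a} u~a = begin
    1                               ≡⟨ cong₂ (λ e d → [ e ] * (d ∸ 1)) (adj-sym G u~a) deg-centre ⟨
    twoPathsVia G a u               ≤⟨ ≤-sum (twoPathsVia G a) u ⟩
    twoPaths G a                    ∎
    where open ≤-Reasoning

-- Reattaching a vertex of degree 2

m+[1+n]≤o+1⇒m+n≤o : ∀ {m n o} → m + suc n ≤ o + 1 → m + n ≤ o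
m+[1+n]≤o+1⇒m+n≤o {m} {n} {o} h =
  +-cancelʳ-≤ 1 (m + n) o (subst (_≤ o + 1) (trans (+-suc m n) (+-comm 1 (m + n))) h)

m+n≤o⇒d*m+d*n≤d*o : ∀ d {m n o} → m + n ≤ o → d * m + d * n ≤ d * o
m+n≤o⇒d*m+d*n≤d*o d {m} {n} {o} h = subst (_≤ d * o) (*-distribˡ-+ d m n) (*-monoʳ-≤ d h)

-- u is taken out of the path v – u – w, v and w become adjacent, and u hangs on z.
reattach : ∀ {n} (G : Graph n) (u v w z : Fin n) → v ≢ w → z ≢ u → Graph n
reattach {n} G u v w z v≢w z≢u = record { adj = adj′ ; sym = adj′-comm ; irrefl = adj′-irrefl }
  where
  adj′ : Fin n → Fin n → Bool
  adj′ x y = if does (x ≟ u) then does (y ≟ z)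
             else if does (y ≟ u) then does (x ≟ z)
             else adj G x y ∨ joins v w x y

  adj′-comm : ∀ x y → adj′ x y ≡ adj′ y x
  adj′-comm x y with x ≟ u | y ≟ u
  ... | yes refl | yes refl = refl
  ... | yes refl | no _     = refl
  ... | no _     | yes refl = refl
  ... | no _     | no _     = cong₂ _∨_ (adj-comm G x y) (joins-comm x y)

  adj′-irrefl : ∀ x → adj′ x x ≡ false
  adj′-irrefl x with x ≟ u
  ... | yes refl = dec-false (u ≟ z) (≢-sym z≢u)
  ... | no _     = cong₂ _∨_ (irrefl G x) (joins-irrefl v≢w x)

module Reattach {n} {G : Graph n} (tree : IsTree G) {u v w} (N : Neighbours G u v w)
                {z} (z≢u : z ≢ u) where
  open Neighbours N

  T′ : Graph n
  T′ = reattach G u v w z v≢w z≢u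

  private
    v≢u : v ≢ u
    v≢u = ≢-sym (adj⇒≢ G u~v)

    w≢u : w ≢ u
    w≢u = ≢-sym (adj⇒≢ G u~w)

  adj-centre : ∀ y → adj T′ u y ≡ does (y ≟ z)
  adj-centre y rewrite dec-true (u ≟ u) refl = refl

  adj-to-centre : ∀ {x} → x ≢ u → adj T′ x u ≡ does (x ≟ z)
  adj-to-centre {x} x≢u rewrite dec-false (x ≟ u) x≢u | dec-true (u ≟ u) refl = refl

  adj-away : ∀ {x y} → x ≢ u → y ≢ u → adj T′ x y ≡ adj G x y ∨ joins v w x y
  adj-away {x} {y} x≢u y≢u rewrite dec-false (x ≟ u) x≢u | dec-false (y ≟ u) y≢u = refl

  adj-kept : ∀ {x y} → x ≢ u → y ≢ u → adj G x y ≡ true → adj T′ x y ≡ true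
  adj-kept x≢u y≢u x~y = trans (adj-away x≢u y≢u) (cong (_∨ _) x~y)

  v≁w : adj G v w ≡ false
  v≁w = tree-triangle-free tree (adj-sym G u~v) u~w

  v~′w : adj T′ v w ≡ true
  v~′w = trans (adj-away v≢u w≢u)
    (trans (cong (adj G v w ∨_) (trans (joins-left v≢w w) (dec-true (w ≟ w) refl))) (∨-zeroʳ _))

  u~′z : adj T′ u z ≡ true
  u~′z = trans (adj-centre z) (dec-true (z ≟ z) refl)

  deg-centre′ : deg T′ u ≡ 1
  deg-centre′ = trans (count-cong adj-centre) (count-≟ z)

  deg-reattach : ∀ {x} → x ≢ u → deg T′ x ≡ deg G x + 𝟙 z x
  deg-reattach {x} x≢u = +-cancelʳ-≡ (𝟙 v x + 𝟙 w x) _ _ (begin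
    deg T′ x + (𝟙 v x + 𝟙 w x)
      ≡⟨ cong₂ _+_ (count≡sum (adj T′ x)) (sym [h-u]) ⟩
    sum (λ y → [ adj T′ x y ]) + [ h u ]
      ≡⟨ sum-≡-except u (λ y≢u → cong [_] (adj-away x≢u y≢u)) ⟩
    sum (λ y → [ h y ]) + [ adj T′ x u ]
      ≡⟨ cong₂ _+_ sum-h (cong [_] (adj-to-centre x≢u)) ⟩
    deg G x + (𝟙 v x + 𝟙 w x) + 𝟙 z x
      ≡⟨ xy∙z≈xz∙y (deg G x) _ _ ⟩
    deg G x + 𝟙 z x + (𝟙 v x + 𝟙 w x) ∎)
    where
    open ≡-Reasoning
    h = λ y → adj G x y ∨ joins v w x y

    [h-u] : [ h u ] ≡ 𝟙 v x + 𝟙 w x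
    [h-u] = trans (cong [_] (trans h-u (adj-comm G x u))) ([adj-centre] N x)
      where
      h-u : h u ≡ adj G x u
      h-u = trans (cong (adj G x u ∨_) (trans (joins-comm x u) (joins-away x (≢-sym v≢u) (≢-sym w≢u))))
                  (∨-identityʳ _)

    disjoint : ∀ y → adj G x y ∧ joins v w x y ≡ false
    disjoint y with joins v w x y in j
    ... | false = ∧-zeroʳ _
    ... | true with joins⇒ {a = v} {b = w} {x} {y} j
    ...   | inj₁ (refl , refl) = trans (∧-identityʳ _) v≁w
    ...   | inj₂ (refl , refl) = trans (∧-identityʳ _) (trans (adj-comm G w v) v≁w)

    sum-h : sum (λ y → [ h y ]) ≡ deg G x + (𝟙 v x + 𝟙 w x)
    sum-h = begin
      sum (λ y → [ h y ])
        ≡⟨ sum-cong-≗ (λ y → [∨]-disjoint (adj G x y) (joins v w x y) (disjoint y)) ⟩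
      sum (λ y → [ adj G x y ] + [ joins v w x y ])
        ≡⟨ ∑-distrib-+ (λ y → [ adj G x y ]) (λ y → [ joins v w x y ]) ⟩
      sum (λ y → [ adj G x y ]) + sum (λ y → [ joins v w x y ])
        ≡⟨ cong₂ _+_ (sym (count≡sum (adj G x)))
                     (trans (sym (count≡sum (joins v w x))) (count-joins v≢w x)) ⟩
      deg G x + (𝟙 v x + 𝟙 w x) ∎

  deg-grows : ∀ {x} → x ≢ u → deg G x ≤ deg T′ x
  deg-grows {x} x≢u = subst (deg G x ≤_) (sym (deg-reattach x≢u)) (m≤m+n (deg G x) (𝟙 z x))

  sumDeg-reattach : sumV (deg T′) ≡ sumV (deg G)
  sumDeg-reattach = begin
    sumV (deg T′)                       ≡⟨ sumV≡sum (deg T′) ⟩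
    sum (deg T′)                        ≡⟨ +-cancelʳ-≡ 2 _ _ (begin
      sum (deg T′) + 2                    ≡⟨ cong₂ (λ d k → sum (deg T′) + (d + k))
                                                   (deg-centre N) (𝟙-other (≢-sym z≢u)) ⟨
      sum (deg T′) + (deg G u + 𝟙 z u)    ≡⟨ sum-≡-except u deg-reattach ⟩
      sum (λ x → deg G x + 𝟙 z x) + deg T′ u
                                          ≡⟨ cong₂ _+_ (∑-distrib-+ (deg G) (𝟙 z)) deg-centre′ ⟩
      sum (deg G) + sum (𝟙 z) + 1         ≡⟨ cong (λ s → sum (deg G) + s + 1) (sum-𝟙 z) ⟩
      sum (deg G) + 1 + 1                 ≡⟨ +-assoc (sum (deg G)) 1 1 ⟩
      sum (deg G) + 2                     ∎) ⟩
    sum (deg G)                         ≡⟨ sumV≡sum (deg G) ⟨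
    sumV (deg G)                        ∎
    where open ≡-Reasoning

  walk-to-v : ∀ {x} → x ≢ u → Walk G x v → Walk T′ x v
  walk-to-v _   here = here
  walk-to-v x≢u (step {w = y} x~y p) with y ≟ u
  ... | no y≢u = step (adj-kept x≢u y≢u x~y) (walk-to-v y≢u p)
  ... | yes refl with only (adj-sym G x~y)
  ...   | inj₁ refl = here
  ...   | inj₂ refl = step (adj-sym T′ {v} {w} v~′w) here

  tree′ : IsTree T′
  tree′ = (λ x y → to-v x ++ʷ reverseʷ (to-v y)) , trans sumDeg-reattach (proj₂ tree)
    where
    to-v : ∀ x → Walk T′ x v
    to-v = by-point u (step u~′z (walk-to-v z≢u (proj₁ tree z v)))
                      (λ x≢u → walk-to-v x≢u (proj₁ tree _ v))

  chemical′ : (∀ x → deg G x ≤ 4) → deg G z ≤ 3 → ∀ x → deg T′ x ≤ 4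
  chemical′ deg≤4 z≤3 = by-point u (subst (_≤ 4) (sym deg-centre′) (s≤s z≤n))
                                   (λ x≢u → subst (_≤ 4) (sym (deg-reattach x≢u)) (grown _))
    where
    grown : ∀ x → deg G x + 𝟙 z x ≤ 4
    grown = by-point z (subst (λ k → deg G z + k ≤ 4) (sym (𝟙-same z)) (+-monoˡ-≤ 1 z≤3))
                       (λ {y} y≢z → subst (_≤ 4) (sym (trans (cong (deg G y +_) (𝟙-other y≢z))
                                                                 (+-identityʳ _)))
                                          (deg≤4 y))

  twoPaths-centre′ : twoPaths T′ u ≡ deg G z
  twoPaths-centre′ = begin
    sum (λ x → [ adj T′ u x ] * (deg T′ x ∸ 1))
      ≡⟨ sum-cong-≗ (λ x → cong (λ e → [ e ] * (deg T′ x ∸ 1)) (adj-centre x)) ⟩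
    sum (λ x → 𝟙 z x * (deg T′ x ∸ 1))
      ≡⟨ sum-𝟙* z (λ x → deg T′ x ∸ 1) ⟩
    deg T′ z ∸ 1
      ≡⟨ cong (_∸ 1) (deg-reattach z≢u) ⟩
    deg G z + 𝟙 z z ∸ 1
      ≡⟨ cong (λ k → deg G z + k ∸ 1) (𝟙-same z) ⟩
    deg G z + 1 ∸ 1
      ≡⟨ m+n∸n≡m (deg G z) 1 ⟩
    deg G z ∎
    where open ≡-Reasoning

  -- a loses the paths through u, worth d_u − 1 = 1, and gains those through b, worth d′_b − 1.
  twoPaths-joined : ∀ {a b k} → adj G u a ≡ true → adj G u b ≡ true →
                    (∀ x → joins v w a x ≡ does (x ≟ b)) → deg T′ b ≡ 2 + k →
                    twoPaths G a + k ≤ twoPaths T′ a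
  twoPaths-joined {a} {b} {k} u~a u~b joins-a deg′-b =
    m+[1+n]≤o+1⇒m+n≤o (sum-≤-except₂ b≢u at-u at-b elsewhere)
    where
    open ≤-Reasoning
    a≢u = ≢-sym (adj⇒≢ G u~a)
    b≢u = ≢-sym (adj⇒≢ G u~b)

    adj-a : ∀ {x} → x ≢ u → adj T′ a x ≡ adj G a x ∨ does (x ≟ b)
    adj-a {x} x≢u = trans (adj-away a≢u x≢u) (cong (adj G a x ∨_) (joins-a x))

    a~′b : adj T′ a b ≡ true
    a~′b = trans (adj-a b≢u) (trans (cong (adj G a b ∨_) (dec-true (b ≟ b) refl)) (∨-zeroʳ _))

    at-u : twoPathsVia G a u ≤ twoPathsVia T′ a u + 1
    at-u = begin
      twoPathsVia G a u       ≡⟨ cong₂ (λ e d → [ e ] * (d ∸ 1)) (adj-sym G u~a) (deg-centre N) ⟩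
      1                       ≤⟨ m≤n+m 1 _ ⟩
      twoPathsVia T′ a u + 1  ∎

    at-b : twoPathsVia G a b + suc k ≤ twoPathsVia T′ a b
    at-b = ≤-reflexive (begin-equality
      twoPathsVia G a b + suc k
        ≡⟨ cong (λ e → [ e ] * (deg G b ∸ 1) + suc k) (tree-triangle-free tree (adj-sym G u~a) u~b) ⟩
      suc k
        ≡⟨ *-identityˡ (suc k) ⟨
      1 * suc k
        ≡⟨ cong₂ (λ e d → [ e ] * (d ∸ 1)) a~′b deg′-b ⟨
      twoPathsVia T′ a b ∎)

    elsewhere : ∀ {x} → x ≢ u → x ≢ b → twoPathsVia G a x ≤ twoPathsVia T′ a x
    elsewhere {x} x≢u x≢b = twoPathsVia-mono {G = G} {T′} {a} {x}
      (trans (adj-a x≢u) (trans (cong (adj G a x ∨_) (dec-false (x ≟ b) x≢b)) (∨-identityʳ _)))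
      (deg-grows x≢u)

  ZC1*-term-grows : ∀ {a} → a ≢ u → a ≢ v → a ≢ w → ZC1*-term G a ≤ ZC1*-term T′ a
  ZC1*-term-grows {a} a≢u a≢v a≢w = *-mono-≤ (deg-grows a≢u) (sum-mono-≤ (by-point u at-u elsewhere))
    where
    at-u : twoPathsVia G a u ≤ twoPathsVia T′ a u
    at-u = subst (_≤ twoPathsVia T′ a u)
                 (sym (cong (λ e → [ e ] * (deg G u ∸ 1)) (¬adj-centre N a≢v a≢w))) z≤n
    elsewhere : ∀ {x} → x ≢ u → twoPathsVia G a x ≤ twoPathsVia T′ a x
    elsewhere {x} x≢u = twoPathsVia-mono {G = G} {T′} {a} {x}
      (trans (adj-away a≢u x≢u) (trans (cong (adj G a x ∨_) (joins-away x a≢v a≢w)) (∨-identityʳ _)))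
      (deg-grows x≢u)

module _ {n} {G : Graph n} (tree : IsTree G) {u v w} (N : Neighbours G u v w) where
  open Neighbours N

  private
    v≢u : v ≢ u
    v≢u = ≢-sym (adj⇒≢ G u~v)
    w≢u : w ≢ u
    w≢u = ≢-sym (adj⇒≢ G u~w)

  reattach-increases-ZC1* : ∀ {z} (z≢u : z ≢ u) {L A B} →
    ZC1*-term G u ≤ ZC1*-term (Reattach.T′ tree N z≢u) u + L →
    ZC1*-term G v + A ≤ ZC1*-term (Reattach.T′ tree N z≢u) v →
    ZC1*-term G w + B ≤ ZC1*-term (Reattach.T′ tree N z≢u) w →
    L < A + B → ZC1* G < ZC1* (Reattach.T′ tree N z≢u)
  reattach-increases-ZC1* z≢u at-u at-v at-w L<A+B =
    subst₂ _<_ (sym (ZC1*-tree tree)) (sym (ZC1*-tree tree′))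
      (sum-<-except₃ v≢u w≢u (≢-sym v≢w) at-u at-v at-w ZC1*-term-grows L<A+B)
    where open Reattach tree N z≢u

  reattach-to-neighbour-increases-ZC1* : ∀ {α β} → deg G v ≡ 2 + α → deg G w ≡ 2 + β →
                                         ZC1* G < ZC1* (Reattach.T′ tree N v≢u)
  reattach-to-neighbour-increases-ZC1* {α} {β} deg-v deg-w =
    reattach-increases-ZC1* v≢u at-u at-v at-w L<A+B
    where
    open Reattach tree N v≢u
    open ≤-Reasoning

    centre-identity : ∀ α β → 2 * ((1 + α) + (1 + β)) ≡ 1 * (2 + α) + (2 + α + 2 * β)
    centre-identity = solve-∀
    v-identity : ∀ α β t → (2 + α) * t + (t + (3 + α) * β) ≡ (3 + α) * (t + β)
    v-identity = solve-∀
    gain-identity : ∀ α β →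
      (1 + (3 + α) * β) + (2 + β) * (1 + α) ≡ suc (2 + α + 2 * β) + (α + 2 * β + 2 * (α * β))
    gain-identity = solve-∀

    deg′-v : deg T′ v ≡ 3 + α
    deg′-v = trans (deg-reattach v≢u) (trans (cong₂ _+_ deg-v (𝟙-same v)) (+-comm (2 + α) 1))
    deg′-w : deg T′ w ≡ 2 + β
    deg′-w = trans (deg-reattach w≢u) (trans (cong₂ _+_ deg-w (𝟙-other (≢-sym v≢w))) (+-identityʳ _))

    at-u : ZC1*-term G u ≤ ZC1*-term T′ u + (2 + α + 2 * β)
    at-u = ≤-reflexive (begin-equality
      ZC1*-term G u
        ≡⟨ trans (ZC1*-term-centre N) (cong₂ (λ d e → 2 * ((d ∸ 1) + (e ∸ 1))) deg-v deg-w) ⟩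
      2 * ((1 + α) + (1 + β))
        ≡⟨ centre-identity α β ⟩
      1 * (2 + α) + (2 + α + 2 * β)
        ≡⟨ cong₂ (λ d t → d * t + (2 + α + 2 * β)) deg-centre′ (trans twoPaths-centre′ deg-v) ⟨
      ZC1*-term T′ u + (2 + α + 2 * β) ∎)

    at-v : ZC1*-term G v + (1 + (3 + α) * β) ≤ ZC1*-term T′ v
    at-v = begin
      deg G v * t + (1 + (3 + α) * β)  ≡⟨ cong (λ d → d * t + (1 + (3 + α) * β)) deg-v ⟩
      (2 + α) * t + (1 + (3 + α) * β)  ≤⟨ +-monoʳ-≤ ((2 + α) * t) (+-monoˡ-≤ _ 1≤t) ⟩
      (2 + α) * t + (t + (3 + α) * β)  ≡⟨ v-identity α β t ⟩
      (3 + α) * (t + β)                ≤⟨ *-monoʳ-≤ (3 + α) t+β≤t′ ⟩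
      (3 + α) * t′                     ≡⟨ cong (_* t′) deg′-v ⟨
      deg T′ v * t′                    ∎
      where
      t = twoPaths G v
      t′ = twoPaths T′ v
      1≤t = 1≤twoPaths-neighbour N u~v
      t+β≤t′ = twoPaths-joined u~v u~w (joins-left v≢w) deg′-w

    at-w : ZC1*-term G w + (2 + β) * (1 + α) ≤ ZC1*-term T′ w
    at-w = begin
      deg G w * t + (2 + β) * (1 + α)  ≡⟨ cong (λ d → d * t + (2 + β) * (1 + α)) deg-w ⟩
      (2 + β) * t + (2 + β) * (1 + α)  ≤⟨ m+n≤o⇒d*m+d*n≤d*o (2 + β) {t} t+[1+α]≤t′ ⟩
      (2 + β) * t′                     ≡⟨ cong (_* t′) deg′-w ⟨
      deg T′ w * t′                    ∎
      where
      t = twoPaths G w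
      t′ = twoPaths T′ w
      t+[1+α]≤t′ = twoPaths-joined u~w u~v (joins-right v≢w) deg′-v

    L<A+B : 2 + α + 2 * β < (1 + (3 + α) * β) + (2 + β) * (1 + α)
    L<A+B = subst (2 + α + 2 * β <_) (sym (gain-identity α β)) (s≤s (m≤m+n _ _))

  reattach-to-leaf-increases-ZC1* : ∀ {ℓ} (ℓ≢u : ℓ ≢ u) → ℓ ≢ v → ℓ ≢ w → deg G v ≡ 4 → deg G w ≡ 4 →
                                    ZC1* G < ZC1* (Reattach.T′ tree N ℓ≢u)
  reattach-to-leaf-increases-ZC1* {ℓ} ℓ≢u ℓ≢v ℓ≢w deg-v deg-w =
    reattach-increases-ZC1* ℓ≢u at-u
      (gain deg-v deg′-v (twoPaths-joined u~v u~w (joins-left v≢w) deg′-w))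
      (gain deg-w deg′-w (twoPaths-joined u~w u~v (joins-right v≢w) deg′-v))
      (m≤m+n 13 3)
    where
    open Reattach tree N ℓ≢u
    open ≤-Reasoning

    deg′-v : deg T′ v ≡ 4
    deg′-v = trans (deg-reattach v≢u) (trans (cong₂ _+_ deg-v (𝟙-other (≢-sym ℓ≢v))) (+-identityʳ 4))
    deg′-w : deg T′ w ≡ 4
    deg′-w = trans (deg-reattach w≢u) (trans (cong₂ _+_ deg-w (𝟙-other (≢-sym ℓ≢w))) (+-identityʳ 4))

    at-u : ZC1*-term G u ≤ ZC1*-term T′ u + 12
    at-u = begin
      ZC1*-term G u
        ≡⟨ trans (ZC1*-term-centre N) (cong₂ (λ d e → 2 * ((d ∸ 1) + (e ∸ 1))) deg-v deg-w) ⟩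
      12
        ≤⟨ m≤n+m 12 (ZC1*-term T′ u) ⟩
      ZC1*-term T′ u + 12 ∎

    gain : ∀ {a} → deg G a ≡ 4 → deg T′ a ≡ 4 → twoPaths G a + 2 ≤ twoPaths T′ a →
           ZC1*-term G a + 8 ≤ ZC1*-term T′ a
    gain {a} deg-a deg′-a joined = begin
      deg G a * twoPaths G a + 8  ≡⟨ cong (λ d → d * twoPaths G a + 8) deg-a ⟩
      4 * twoPaths G a + 4 * 2    ≤⟨ m+n≤o⇒d*m+d*n≤d*o 4 {twoPaths G a} joined ⟩
      4 * twoPaths T′ a           ≡⟨ cong (_* twoPaths T′ a) deg′-a ⟨
      deg T′ a * twoPaths T′ a    ∎

module _ {n} {G : Graph n} (tree : IsTree G) (deg≤4 : ∀ x → deg G x ≤ 4) where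

  private
    reattach-at-neighbour : ∀ {u v w} (N : Neighbours G u v w) → 2 ≤ deg G v → 2 ≤ deg G w →
                            deg G v ≤ 3 → Σ (Graph n) λ T′ → IsChemicalTree T′ × ZC1* G < ZC1* T′
    reattach-at-neighbour N 2≤v 2≤w v≤3 =
      T′ , (tree′ , chemical′ deg≤4 v≤3) ,
      reattach-to-neighbour-increases-ZC1* tree N (sym (m+[n∸m]≡n 2≤v)) (sym (m+[n∸m]≡n 2≤w))
      where open Reattach tree N (≢-sym (adj⇒≢ G (Neighbours.u~v N)))

  larger-chemical-tree : ∀ {u v w} → Neighbours G u v w → 2 ≤ deg G v → 2 ≤ deg G w →
                         Σ (Graph n) λ T′ → IsChemicalTree T′ × ZC1* G < ZC1* T′
  larger-chemical-tree {u} {v} {w} N 2≤v 2≤w with deg G v ≤? 3 | deg G w ≤? 3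
  ... | yes v≤3 | _       = reattach-at-neighbour N 2≤v 2≤w v≤3
  ... | no _    | yes w≤3 = reattach-at-neighbour (neighbours-swap N) 2≤w 2≤v w≤3
  ... | no v≰3  | no w≰3  =
    T′ , (tree′ , chemical′ deg≤4 (≤-trans (≤-reflexive deg-ℓ) (s≤s z≤n))) ,
    reattach-to-leaf-increases-ZC1* tree N ℓ≢u ℓ≢v ℓ≢w deg-v deg-w
    where
    open Neighbours N
    deg-v = ≤-antisym (deg≤4 v) (≰⇒> v≰3)
    deg-w = ≤-antisym (deg≤4 w) (≰⇒> w≰3)
    leaf = tree-has-leaf tree (adj⇒≢ G u~v)
    ℓ = proj₁ leaf
    deg-ℓ = proj₂ leaf
    ℓ≢u : ℓ ≢ u
    ℓ≢u = deg-≢ {G = G} deg-ℓ (deg-centre N) λ ()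
    ℓ≢v : ℓ ≢ v
    ℓ≢v = deg-≢ {G = G} deg-ℓ deg-v λ ()
    ℓ≢w : ℓ ≢ w
    ℓ≢w = deg-≢ {G = G} deg-ℓ deg-w λ ()
    open Reattach tree N ℓ≢u

lemma3p4 : (n : ℕ) → 5 ≤ n → (T* : Graph n) → IsChemicalTree T*
    → ((T : Graph n) → IsChemicalTree T → ZC1* T ≤ ZC1* T*)
    → (u : Fin n) → deg T* u ≡ 2
    → Σ (Fin n) (λ w → (adj T* u w ≡ true) × (deg T* w ≡ 1))
lemma3p4 n _ T* (tree , deg≤4) maximal u deg-u with deg≡2⇒neighbours T* deg-u
... | v , w , N with deg T* v ℕ.≟ 1 | deg T* w ℕ.≟ 1
...   | yes v-leaf | _          = v , Neighbours.u~v N , v-leaf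
...   | no _       | yes w-leaf = w , Neighbours.u~w N , w-leaf
...   | no v-inner | no w-inner
  with larger-chemical-tree tree deg≤4 N (2≤deg-non-leaf T* (Neighbours.u~v N) v-inner)
                                         (2≤deg-non-leaf T* (Neighbours.u~w N) w-inner)
...     | T′ , chemical , larger = ⊥-elim (<⇒≱ larger (maximal T′ chemical))
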